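{- Let $S$ and $T$ be sets of surreals with $u < v$ for all $u\in S$, $v \in T$. Then $w = \mathrm{sep}(\sup^* S, \inf^* T)$ is the shortest surreal separating $S$ and $T$, and every surreal separating $S$ and $T$ is a prolongment of $w$.
   Context: A surreal is a function $s$ from some ordinal $\ell(s)$ (its length, possibly $0$) to $\{+,-\}$; for $\gamma \geq \ell(s)$, $s(\gamma)$ is called undefined. "$s(\gamma)=t(\gamma)$" means both undefined or both defined and equal. Order: for distinct $s,t$, with $\gamma$ least such that $s(\gamma)\neq t(\gamma)$, $s<t$ iff $s(\gamma)<t(\gamma)$ in the ordering $- < \text{undefined} < +$. For $\gamma \leq \ell(s)$, $s_{\restriction\gamma}$ is the surreal of length $\gamma$ agreeing with $s$ below $\gamma$; for $\gamma > \ell(s)$, $s_{\restriction\gamma}=s$; $s_{\restriction\leq\gamma} := s_{\restriction(\gamma+1)}$. A surreal $w$ is a prolongment of $t$ if $t = w_{\restriction\gamma}$ for some ordinal $\gamma$ (proper if $\gamma<\ell(w)$). For a surreal $u$ of length $\beta$, $u^\frown +$ (resp. $u^\frown -$) is the surreal of length $\beta+1$ extending $u$ with value $+$ (resp. $-$) at $\beta$. For a set $S$ of surreals: if $S$ has a maximum $u$, $\sup^* S = u^\frown +$; otherwise $\sup^* S$ is the surreal $s$ such that $s(\gamma)$ is defined iff there is $u \in S$ with $u(\gamma)$ defined and $u'_{\restriction\leq\gamma} = u_{\restriction\leq\gamma}$ for all $u'\in S$ with $u'\geq u$, in which case $s(\gamma)=u(\gamma)$. Symmetrically, for a set $T$: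 if $T$ has a minimum $v$, $\inf^* T = v^\frown -$; otherwise $\inf^* T$ is the surreal $t$ such that $t(\gamma)$ is defined iff there is $v \in T$ with $v(\gamma)$ defined and $v'_{\restriction\leq\gamma} = v_{\restriction\leq\gamma}$ for all $v'\in T$ with $v'\leq v$, in which case $t(\gamma)=v(\gamma)$. A surreal $w$ separates $S$ and $T$ if $u < w < v$ for all $u\in S$, $v\in T$. The separator $\mathrm{sep}(s,t)$ of an ordered pair of surreals: (a) if $s=t$, $\mathrm{sep}(s,t)=s$; (b) if there is $\gamma$ with $s(\gamma)$, $t(\gamma)$ both defined and distinct, take the least such $\gamma$ and set $\mathrm{sep}(s,t)=s_{\restriction\gamma}=t_{\restriction\gamma}$; (c) if $t$ is a proper prolongment of $s$ with $\ell(s)=\alpha$, let $\mathrm{sep}(s,t)=t_{\restriction\varepsilon}$ for the least $\varepsilon\geq\alpha$ with $t(\varepsilon)=+$, and $\mathrm{sep}(s,t)=t$ if no such $\varepsilon$ exists; (d) if $s$ is a proper prolongment of $t$ with $\ell(t)=\beta$, let $\mathrm{sep}(s,t)=s_{\restriction\varepsilon}$ for the least $\varepsilon\geq\beta$ with $s(\varepsilon)=-$, and $\mathrm{sep}(s,t)=s$ if no such $\varepsilon$ exists. -}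

module Defs where

open import Level using (0ℓ)
open import Data.Product using (Σ; _×_; _,_)
open import Data.Sum using (_⊎_)
open import Relation.Binary.Core using (Rel)
open import Relation.Binary.Structures using (IsStrictTotalOrder)
open import Relation.Binary.PropositionalEquality using (_≡_; _≢_)
open import Relation.Nullary using (¬_)
open import Induction.WellFounded using (WellFounded)

-- The ordinals (lengths / positions of sign sequences) are modelled by an
-- arbitrary well-ordered type: a strict total order that is well-founded.
record WellOrder : Set₁ where
  field
    Carrier            : Set
    _<_                : Rel Carrier 0ℓ
    isStrictTotalOrder : IsStrictTotalOrder _≡_ _<_
    wellFounded        : WellFounded _<_

-- Values of a sign sequence at a position: - < undefined < +
data Val : Set where
  neg undef pos : Val

data _<ᵛ_ : Val → Val → Set where
  neg<undef : neg <ᵛ undef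
  neg<pos   : neg <ᵛ pos
  undef<pos : undef <ᵛ pos

module _ (O : WellOrder) where
  open WellOrder O

  -- A surreal: a sign sequence of length `len`; `at s γ` is s(γ),
  -- which is undef exactly when γ ≥ len.
  record Surreal : Set where
    field
      len        : Carrier
      at         : Carrier → Val
      def-below  : ∀ γ → γ < len → at γ ≢ undef
      undef-from : ∀ γ → ¬ (γ < len) → at γ ≡ undef
  open Surreal public

  _≈ˢ_ : Surreal → Surreal → Set
  s ≈ˢ t = ∀ γ → at s γ ≡ at t γ

  _<ˢ_ : Surreal → Surreal → Set
  s <ˢ t = Σ Carrier λ γ → (∀ δ → δ < γ → at s δ ≡ at t δ) × (at s γ <ᵛ at t γ)

  _≤ˢ_ : Surreal → Surreal → Set
  s ≤ˢ t = (s <ˢ t) ⊎ (s ≈ˢ t)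

  IsRestr : Surreal → Surreal → Carrier → Set
  IsRestr r s γ = ∀ δ → (δ < γ → at r δ ≡ at s δ) × (¬ (δ < γ) → at r δ ≡ undef)

  AgreeLe : Surreal → Surreal → Carrier → Set
  AgreeLe u u' γ = ∀ δ → ¬ (γ < δ) → at u δ ≡ at u' δ

  IsProlongment : Surreal → Surreal → Set
  IsProlongment w t = Σ Carrier λ γ → IsRestr t w γ

  IsProperProlongment : Surreal → Surreal → Set
  IsProperProlongment w t = Σ Carrier λ γ → (γ < len w) × IsRestr t w γ

  IsExtend : Surreal → Val → Surreal → Set
  IsExtend u v s = ∀ δ → (δ < len u → at s δ ≡ at u δ)
                        × (δ ≡ len u → at s δ ≡ v)
                        × (len u < δ → at s δ ≡ undef)

  IsMax : (Surreal → Set) → Surreal → Set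
  IsMax S u = S u × (∀ u' → S u' → u' ≤ˢ u)

  IsMin : (Surreal → Set) → Surreal → Set
  IsMin T v = T v × (∀ v' → T v' → v ≤ˢ v')

  SupWitness : (Surreal → Set) → Surreal → Carrier → Set
  SupWitness S u γ = S u × (at u γ ≢ undef) × (∀ u' → S u' → u ≤ˢ u' → AgreeLe u' u γ)

  InfWitness : (Surreal → Set) → Surreal → Carrier → Set
  InfWitness T v γ = T v × (at v γ ≢ undef) × (∀ v' → T v' → v' ≤ˢ v → AgreeLe v' v γ)

  IsSupStar : (Surreal → Set) → Surreal → Set
  IsSupStar S s =
      (Σ Surreal λ u → IsMax S u × IsExtend u pos s)
    ⊎ ((¬ Σ Surreal λ u → IsMax S u)
       × (∀ γ → (Σ Surreal λ u → SupWitness S u γ × (at s γ ≡ at u γ))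
              ⊎ ((¬ Σ Surreal λ u → SupWitness S u γ) × (at s γ ≡ undef))))

  IsInfStar : (Surreal → Set) → Surreal → Set
  IsInfStar T t =
      (Σ Surreal λ v → IsMin T v × IsExtend v neg t)
    ⊎ ((¬ Σ Surreal λ v → IsMin T v)
       × (∀ γ → (Σ Surreal λ v → InfWitness T v γ × (at t γ ≡ at v γ))
              ⊎ ((¬ Σ Surreal λ v → InfWitness T v γ) × (at t γ ≡ undef))))

  Differ : Surreal → Surreal → Carrier → Set
  Differ s t γ = (at s γ ≢ undef) × (at t γ ≢ undef) × (at s γ ≢ at t γ)

  IsSep : Surreal → Surreal → Surreal → Set
  IsSep s t w =
      ((s ≈ˢ t) × (w ≈ˢ s))
    ⊎
      (Σ Carrier λ γ → Differ s t γ × (∀ δ → δ < γ → ¬ Differ s t δ) × IsRestr w s γ)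
    ⊎
      (IsProperProlongment t s
       × ((Σ Carrier λ ε → ¬ (ε < len s) × (at t ε ≡ pos)
              × (∀ δ → ¬ (δ < len s) → δ < ε → at t δ ≢ pos) × IsRestr w t ε)
          ⊎ ((∀ ε → ¬ (ε < len s) → at t ε ≢ pos) × (w ≈ˢ t))))
    ⊎
      (IsProperProlongment s t
       × ((Σ Carrier λ ε → ¬ (ε < len t) × (at s ε ≡ neg)
              × (∀ δ → ¬ (δ < len t) → δ < ε → at s δ ≢ neg) × IsRestr w s ε)
          ⊎ ((∀ ε → ¬ (ε < len t) → at s ε ≢ neg) × (w ≈ˢ s))))

  Separates : Surreal → (Surreal → Set) → (Surreal → Set) → Set
  Separates w S T = (∀ u → S u → u <ˢ w) × (∀ v → T v → w <ˢ v)

{-# OPTIONS --safe #-}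
-- Write x <ʳ s when x < s and the first difference lies where s is defined, and dually t <ˡ x.
-- Every member of S is <ʳ sup* S, while no upper bound of S is, because each sign of sup* S is
-- realised by some member of S; inf* T is the mirror image (signs flipped) of the sup* of the
-- mirrored T. For w = sep(s, t) the cases (a)-(d) all give: x <ʳ s forces x < w, t <ˡ x forces
-- w < x, and wherever w is defined its sign is pinned for every other x, because there w agrees
-- with s unless it is −, and with t unless it is +. By well-founded induction every x with
-- neither x <ʳ s nor t <ˡ x therefore prolongs w, hence is not shorter. A separator of S and T
-- is such an x, while the members of S and T fall on the two sides of w.
module Submission where

open import Defs
open import Level using (0ℓ)
open import Data.Product using (Σ; _×_; _,_; proj₁; proj₂)
open import Data.Sum using (_⊎_; inj₁; inj₂; [_,_]′)
open import Data.Empty using (⊥; ⊥-elim)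
open import Relation.Nullary using (¬_; yes; no)
open import Relation.Binary.PropositionalEquality
  using (_≡_; _≢_; refl; sym; trans; cong; subst; subst₂)
open import Relation.Binary.Definitions using (Tri; tri<; tri≈; tri>)
open import Relation.Binary.Structures using (IsStrictTotalOrder)
open import Axiom.ExcludedMiddle using (ExcludedMiddle)
open import Axiom.DoubleNegationElimination using (em⇒dne)
open import Induction.WellFounded using (Acc; acc)

<ᵛ-irrefl : ∀ {a} → ¬ (a <ᵛ a)
<ᵛ-irrefl ()

<ᵛ-asym : ∀ {a b} → a <ᵛ b → ¬ (b <ᵛ a)
<ᵛ-asym neg<undef ()
<ᵛ-asym neg<pos   ()
<ᵛ-asym undef<pos ()

pos-maximal : ∀ {a} → ¬ (pos <ᵛ a)
pos-maximal ()

neg-minimal : ∀ {a} → ¬ (a <ᵛ neg)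
neg-minimal ()

<ᵛ-cmp : ∀ a b → Tri (a <ᵛ b) (a ≡ b) (b <ᵛ a)
<ᵛ-cmp neg   neg   = tri≈ (λ ()) refl (λ ())
<ᵛ-cmp neg   undef = tri< neg<undef (λ ()) (λ ())
<ᵛ-cmp neg   pos   = tri< neg<pos (λ ()) (λ ())
<ᵛ-cmp undef neg   = tri> (λ ()) (λ ()) neg<undef
<ᵛ-cmp undef undef = tri≈ (λ ()) refl (λ ())
<ᵛ-cmp undef pos   = tri< undef<pos (λ ()) (λ ())
<ᵛ-cmp pos   neg   = tri> (λ ()) (λ ()) neg<pos
<ᵛ-cmp pos   undef = tri> (λ ()) (λ ()) undef<pos
<ᵛ-cmp pos   pos   = tri≈ (λ ()) refl (λ ())

<undef⇒neg : ∀ {a} → a <ᵛ undef → a ≡ neg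
<undef⇒neg neg<undef = refl

undef<⇒pos : ∀ {a} → undef <ᵛ a → a ≡ pos
undef<⇒pos undef<pos = refl

<pos⇒neg⊎undef : ∀ {a} → a <ᵛ pos → a ≡ neg ⊎ a ≡ undef
<pos⇒neg⊎undef neg<pos   = inj₁ refl
<pos⇒neg⊎undef undef<pos = inj₂ refl

neg<⇒undef⊎pos : ∀ {a} → neg <ᵛ a → a ≡ undef ⊎ a ≡ pos
neg<⇒undef⊎pos neg<undef = inj₁ refl
neg<⇒undef⊎pos neg<pos   = inj₂ refl

pos≢undef : pos ≢ undef
pos≢undef ()

neg≢undef : neg ≢ undef
neg≢undef ()

defined-≢pos⇒neg : ∀ {a} → a ≢ undef → a ≢ pos → a ≡ neg
defined-≢pos⇒neg {neg}   _ _ = refl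
defined-≢pos⇒neg {undef} d _ = ⊥-elim (d refl)
defined-≢pos⇒neg {pos}   _ p = ⊥-elim (p refl)

defined-≢neg⇒pos : ∀ {a} → a ≢ undef → a ≢ neg → a ≡ pos
defined-≢neg⇒pos {neg}   _ n = ⊥-elim (n refl)
defined-≢neg⇒pos {undef} d _ = ⊥-elim (d refl)
defined-≢neg⇒pos {pos}   _ _ = refl

defined-≢⇒signs : ∀ {a b} → a ≢ undef → b ≢ undef → a ≢ b →
  (a ≡ neg × b ≡ pos) ⊎ (a ≡ pos × b ≡ neg)
defined-≢⇒signs {neg}   {neg}   _ _ n = ⊥-elim (n refl)
defined-≢⇒signs {neg}   {pos}   _ _ _ = inj₁ (refl , refl)
defined-≢⇒signs {pos}   {neg}   _ _ _ = inj₂ (refl , refl)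
defined-≢⇒signs {pos}   {pos}   _ _ n = ⊥-elim (n refl)
defined-≢⇒signs {undef}         a _ _ = ⊥-elim (a refl)
defined-≢⇒signs {neg}   {undef} _ b _ = ⊥-elim (b refl)
defined-≢⇒signs {pos}   {undef} _ b _ = ⊥-elim (b refl)

flip : Val → Val
flip neg   = pos
flip undef = undef
flip pos   = neg

flip-involutive : ∀ a → flip (flip a) ≡ a
flip-involutive neg   = refl
flip-involutive undef = refl
flip-involutive pos   = refl

flip-injective : ∀ {a b} → flip a ≡ flip b → a ≡ b
flip-injective {a} {b} e =
  trans (sym (flip-involutive a)) (trans (cong flip e) (flip-involutive b))

flip-≢undef : ∀ {a} → a ≢ undef → flip a ≢ undef
flip-≢undef a≢undef e = a≢undef (flip-injective e)

flip-<ᵛ : ∀ {a b} → a <ᵛ b → flip b <ᵛ flip a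
flip-<ᵛ neg<undef = undef<pos
flip-<ᵛ neg<pos   = neg<pos
flip-<ᵛ undef<pos = neg<undef

flip-<ᵛ⁻¹ : ∀ {a b} → flip a <ᵛ flip b → b <ᵛ a
flip-<ᵛ⁻¹ {a} {b} lt = subst₂ _<ᵛ_ (flip-involutive b) (flip-involutive a) (flip-<ᵛ lt)

module Separators (O : WellOrder) (em : ExcludedMiddle 0ℓ) where
  open WellOrder O renaming (_<_ to _≺_)
  open IsStrictTotalOrder isStrictTotalOrder
    using (compare; irrefl) renaming (trans to ≺-trans; asym to ≺-asym)

  dne : {P : Set} → ¬ ¬ P → P
  dne = em⇒dne em

  ¬∀⇒∃¬ : {A : Set} {P : A → Set} → ¬ (∀ a → P a) → Σ A λ a → ¬ P a
  ¬∀⇒∃¬ h = dne λ none → h λ a → dne λ ¬Pa → none (a , ¬Pa)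

  ¬→⇒× : {A B : Set} → ¬ (A → B) → A × ¬ B
  ¬→⇒× h = dne (λ ¬a → h λ a → ⊥-elim (¬a a)) , λ b → h λ _ → b

  ≺-irrefl : ∀ {γ} → ¬ γ ≺ γ
  ≺-irrefl = irrefl refl

  ≮-≺-trans : ∀ {γ δ ε} → ¬ γ ≺ δ → γ ≺ ε → δ ≺ ε
  ≮-≺-trans {γ} {δ} {ε} γ≮δ γ<ε with compare δ ε
  ... | tri< δ<ε _ _ = δ<ε
  ... | tri≈ _ refl _ = ⊥-elim (γ≮δ γ<ε)
  ... | tri> _ _ ε<δ = ⊥-elim (γ≮δ (≺-trans γ<ε ε<δ))

  ≺-≮-trans : ∀ {γ δ ε} → γ ≺ δ → ¬ ε ≺ δ → γ ≺ ε
  ≺-≮-trans {γ} {δ} {ε} γ<δ ε≮δ with compare γ ε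
  ... | tri< γ<ε _ _ = γ<ε
  ... | tri≈ _ refl _ = ⊥-elim (ε≮δ γ<δ)
  ... | tri> _ _ ε<γ = ⊥-elim (ε≮δ (≺-trans ε<γ γ<δ))

  least : (P : Carrier → Set) → ∀ {γ} → P γ →
    Σ Carrier λ γ′ → P γ′ × (∀ δ → δ ≺ γ′ → ¬ P δ)
  least P {γ} = go γ (wellFounded γ)
    where
    go : ∀ γ → Acc _≺_ γ → P γ → Σ Carrier λ γ′ → P γ′ × (∀ δ → δ ≺ γ′ → ¬ P δ)
    go γ (acc rs) Pγ with em {Σ Carrier λ δ → δ ≺ γ × P δ}
    ... | yes (δ , δ<γ , Pδ) = go δ (rs δ<γ) Pδ
    ... | no none = γ , Pγ , λ δ δ<γ Pδ → none (δ , δ<γ , Pδ)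

  Sur : Set
  Sur = Surreal O

  _<S_ _≈S_ _≤S_ : Sur → Sur → Set
  _<S_ = _<ˢ_ O
  _≈S_ = _≈ˢ_ O
  _≤S_ = _≤ˢ_ O

  AgreeBelow : Sur → Sur → Carrier → Set
  AgreeBelow x y γ = ∀ δ → δ ≺ γ → at x δ ≡ at y δ

  defined⇒<len : (s : Sur) {γ : Carrier} → at s γ ≢ undef → γ ≺ len s
  defined⇒<len s {γ} d = dne λ γ≮len → d (undef-from s γ γ≮len)

  defined-below : (s : Sur) {γ δ : Carrier} → δ ≺ γ → at s γ ≢ undef → at s δ ≢ undef
  defined-below s {γ} {δ} δ<γ d = def-below s δ (≺-trans δ<γ (defined⇒<len s d))

  undef-above : (s : Sur) {γ δ : Carrier} → γ ≺ δ → at s γ ≡ undef → at s δ ≡ undef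
  undef-above s {γ} {δ} γ<δ u = undef-from s δ λ δ<len → def-below s γ (≺-trans γ<δ δ<len) u

  undef-at-len : (s : Sur) → at s (len s) ≡ undef
  undef-at-len s = undef-from s (len s) ≺-irrefl

  agreeLe⇒agreeBelow : ∀ {x y γ} → AgreeLe O x y γ → AgreeBelow x y γ
  agreeLe⇒agreeBelow ag δ δ<γ = ag δ (≺-asym δ<γ)

  agreeLe-at : ∀ {x y γ} → AgreeLe O x y γ → at x γ ≡ at y γ
  agreeLe-at {γ = γ} ag = ag γ ≺-irrefl

  restriction-defined⇒< : ∀ {r s γ δ} → IsRestr O r s γ → at r δ ≢ undef → δ ≺ γ
  restriction-defined⇒< {δ = δ} r d = dne λ δ≮γ → d (proj₂ (r δ) δ≮γ)

  restriction-agreeLe : ∀ {r s γ δ} → IsRestr O r s γ → δ ≺ γ → AgreeLe O r s δ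
  restriction-agreeLe r δ<γ δ′ δ′≤δ = proj₁ (r δ′) (≮-≺-trans δ′≤δ δ<γ)

  restriction-agrees : ∀ {r s γ δ} → IsRestr O r s γ → δ ≺ len r → at r δ ≡ at s δ
  restriction-agrees {r} {s} {δ = δ} rs δ<len =
    proj₁ (rs δ) (restriction-defined⇒< {r} {s} rs (def-below r δ δ<len))

  ≈S-refl : ∀ {x} → x ≈S x
  ≈S-refl γ = refl

  ≈S-sym : ∀ {x y} → x ≈S y → y ≈S x
  ≈S-sym e γ = sym (e γ)

  <S-respˡ-≈ : ∀ {x y z} → x ≈S y → y <S z → x <S z
  <S-respˡ-≈ e (γ , ag , lt) = γ , (λ δ d → trans (e δ) (ag δ d)) , subst (_<ᵛ _) (sym (e γ)) lt

  ≤S-respˡ-≈ : ∀ {x y z} → x ≈S y → y ≤S z → x ≤S z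
  ≤S-respˡ-≈ {x} {y} {z} e (inj₁ lt) = inj₁ (<S-respˡ-≈ {x} {y} {z} e lt)
  ≤S-respˡ-≈ e (inj₂ e′) = inj₂ λ γ → trans (e γ) (e′ γ)

  ≤S-respʳ-≈ : ∀ {x y z} → x ≤S y → y ≈S z → x ≤S z
  ≤S-respʳ-≈ (inj₁ (γ , ag , lt)) e =
    inj₁ (γ , (λ δ d → trans (ag δ d) (e δ)) , subst (_ <ᵛ_) (e γ) lt)
  ≤S-respʳ-≈ (inj₂ e′) e = inj₂ λ γ → trans (e′ γ) (e γ)

  <S-irrefl : ∀ {x y} → x <S y → ¬ x ≈S y
  <S-irrefl (γ , _ , lt) e = <ᵛ-irrefl (subst (_<ᵛ _) (e γ) lt)

  <S-asym : ∀ {x y} → x <S y → ¬ y <S x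
  <S-asym (γ , ag , lt) (γ′ , ag′ , lt′) with compare γ γ′
  ... | tri< γ<γ′ _ _ = <ᵛ-irrefl (subst (_ <ᵛ_) (ag′ γ γ<γ′) lt)
  ... | tri≈ _ refl _ = <ᵛ-asym lt lt′
  ... | tri> _ _ γ′<γ = <ᵛ-irrefl (subst (_ <ᵛ_) (ag γ′ γ′<γ) lt′)

  ≤S⇒≯ : ∀ {x y} → x ≤S y → ¬ y <S x
  ≤S⇒≯ {x} {y} (inj₁ x<y) = <S-asym {x} {y} x<y
  ≤S⇒≯ {x} {y} (inj₂ x≈y) y<x = <S-irrefl {y} {x} y<x (≈S-sym {x} {y} x≈y)

  <S-at : ∀ {x y γ a b} → AgreeBelow x y γ → at x γ ≡ a → at y γ ≡ b → a <ᵛ b → x <S y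
  <S-at {γ = γ} ag xa yb a<b = γ , ag , subst₂ _<ᵛ_ (sym xa) (sym yb) a<b

  agree-undef⇒≈ : ∀ {x y γ} → AgreeBelow x y γ → at x γ ≡ undef → at y γ ≡ undef → x ≈S y
  agree-undef⇒≈ {x} {y} {γ} ag xu yu δ with compare δ γ
  ... | tri< δ<γ _ _ = ag δ δ<γ
  ... | tri≈ _ refl _ = trans xu (sym yu)
  ... | tri> _ _ γ<δ = trans (undef-above x γ<δ xu) (sym (undef-above y γ<δ yu))

  ended-≤ : ∀ {x y γ} → AgreeBelow x y γ → at x γ ≡ undef → neg <ᵛ at y γ → x ≤S y
  ended-≤ {x} {y} x≡y xu neg<y with neg<⇒undef⊎pos neg<y
  ... | inj₁ yu = inj₂ (agree-undef⇒≈ {x} {y} x≡y xu yu)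
  ... | inj₂ yp = inj₁ (<S-at {x} {y} x≡y xu yp undef<pos)

  <S-cmp : ∀ x y → Tri (x <S y) (x ≈S y) (y <S x)
  <S-cmp x y with em {x ≈S y}
  ... | yes x≈y = tri≈ (λ x<y → <S-irrefl {x} {y} x<y x≈y) x≈y
                       (λ y<x → <S-irrefl {y} {x} y<x (≈S-sym {x} {y} x≈y))
  ... | no x≉y with least (λ γ → at x γ ≢ at y γ) (proj₂ (¬∀⇒∃¬ x≉y))
  ...   | γ , x≢y , before with <ᵛ-cmp (at x γ) (at y γ)
  ...     | tri< lt _ _ = tri< x<y (x≉y) (<S-asym {x} {y} x<y)
    where x<y = γ , (λ δ d → dne (before δ d)) , lt
  ...     | tri≈ _ e _ = ⊥-elim (x≢y e)
  ...     | tri> _ _ gt = tri> (<S-asym {y} {x} y<x) x≉y y<x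
    where y<x = γ , (λ δ d → sym (dne (before δ d))) , gt

  _<ʳ_ : Sur → Sur → Set
  x <ʳ y = Σ Carrier λ γ → AgreeBelow x y γ × at x γ <ᵛ at y γ × at y γ ≢ undef

  _<ˡ_ : Sur → Sur → Set
  x <ˡ y = Σ Carrier λ γ → AgreeBelow x y γ × at x γ <ᵛ at y γ × at x γ ≢ undef

  -- The second alternative is the + that sup* appends to a maximum of S.
  Attained : (Sur → Set) → Sur → Carrier → Set
  Attained S s γ = Σ Sur λ u → S u × AgreeBelow u s γ
    × (at u γ ≡ at s γ ⊎ (at u γ ≡ undef × at s γ ≡ pos))

  attained-upper-bound-≮ʳ : ∀ {S s} → (∀ γ → at s γ ≢ undef → Attained S s γ) →
    ∀ x → (∀ u → S u → u <S x) → ¬ x <ʳ s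
  attained-upper-bound-≮ʳ {S} {s} attained x S<x (γ , x≡s , lt , sd) with attained γ sd
  ... | u , Su , u≡s , reach = ≤S⇒≯ {x} {u} (x≤u reach) (S<x u Su)
    where
    x≡u : AgreeBelow x u γ
    x≡u δ d = trans (x≡s δ d) (sym (u≡s δ d))

    x≤u : at u γ ≡ at s γ ⊎ (at u γ ≡ undef × at s γ ≡ pos) → x ≤S u
    x≤u (inj₁ us) = inj₁ (γ , x≡u , subst (_ <ᵛ_) (sym us) lt)
    x≤u (inj₂ (uu , sp)) with <pos⇒neg⊎undef (subst (_ <ᵛ_) sp lt)
    ... | inj₁ xn = inj₁ (<S-at {x} {u} x≡u xn uu neg<undef)
    ... | inj₂ xu = inj₂ (agree-undef⇒≈ {x} {u} x≡u xu uu)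

  extension-attained : ∀ {S u s} → S u → IsExtend O u pos s →
    ∀ γ → at s γ ≢ undef → Attained S s γ
  extension-attained {u = u} Su ext γ sd with compare γ (len u)
  ... | tri< γ<len _ _ = u , Su , (λ δ d → sym (proj₁ (ext δ) (≺-trans d γ<len)))
                           , inj₁ (sym (proj₁ (ext γ) γ<len))
  ... | tri≈ _ refl _  = u , Su , (λ δ d → sym (proj₁ (ext δ) d))
                           , inj₂ (undef-at-len u , proj₁ (proj₂ (ext γ)) refl)
  ... | tri> _ _ len<γ = ⊥-elim (sd (proj₂ (proj₂ (ext γ)) len<γ))

  ≤⇒<ʳ-extension : ∀ {y u s} → y ≤S u → IsExtend O u pos s → y <ʳ s
  ≤⇒<ʳ-extension {y} {u} {s} y≤u ext = go y≤u
    where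
    s≡u : ∀ {δ} → δ ≺ len u → at s δ ≡ at u δ
    s≡u {δ} = proj₁ (ext δ)

    agree : ∀ {γ} → ¬ len u ≺ γ → AgreeBelow y u γ → AgreeBelow y s γ
    agree γ≤len ag δ δ<γ = trans (ag δ δ<γ) (sym (s≡u (≺-≮-trans δ<γ γ≤len)))

    decided-at-len : AgreeBelow y u (len u) → at y (len u) <ᵛ pos → y <ʳ s
    decided-at-len ag lt = len u , agree ≺-irrefl ag , subst (_ <ᵛ_) (sym s-pos) lt
      , λ su → pos≢undef (trans (sym s-pos) su)
      where s-pos = proj₁ (proj₂ (ext (len u))) refl

    go : y ≤S u → y <ʳ s
    go (inj₂ y≈u) = decided-at-len (λ δ _ → y≈u δ)
      (subst (_<ᵛ pos) (sym (trans (y≈u (len u)) (undef-at-len u))) undef<pos)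
    go (inj₁ (γ , ag , lt)) with compare γ (len u)
    ... | tri< γ<len _ _ = γ , agree (≺-asym γ<len) ag , subst (_ <ᵛ_) (sym (s≡u γ<len)) lt
                             , λ su → def-below u γ γ<len (trans (sym (s≡u γ<len)) su)
    ... | tri≈ _ refl _  = decided-at-len ag
      (subst (_<ᵛ pos) (sym (<undef⇒neg (subst (_ <ᵛ_) (undef-at-len u) lt))) neg<pos)
    ... | tri> _ _ len<γ = ⊥-elim (<ᵛ-irrefl (subst₂ _<ᵛ_ y-undef u-undef lt))
      where
      u-undef = undef-above u len<γ (undef-at-len u)
      y-undef = undef-above y len<γ (trans (ag (len u) len<γ) (undef-at-len u))

  module SupWithoutMax (S : Sur → Set) (s : Sur) (noMax : ¬ Σ Sur λ u → IsMax O S u)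
    (spec : ∀ γ → (Σ Sur λ u → SupWitness O S u γ × (at s γ ≡ at u γ))
                 ⊎ ((¬ Σ Sur λ u → SupWitness O S u γ) × (at s γ ≡ undef))) where

    witness-below : ∀ {u γ δ} → SupWitness O S u γ → δ ≺ γ → SupWitness O S u δ
    witness-below {u} (Su , ud , stable) δ<γ = Su , defined-below u δ<γ ud
      , λ u′ Su′ u≤u′ ε ε≤δ → stable u′ Su′ u≤u′ ε λ γ<ε → ε≤δ (≺-trans δ<γ γ<ε)

    witnesses-agree : ∀ {u u′ γ} → SupWitness O S u γ → SupWitness O S u′ γ → at u γ ≡ at u′ γ
    witnesses-agree {u} {u′} {γ} (Su , _ , stable) (Su′ , _ , stable′) with <S-cmp u u′
    ... | tri< u<u′ _ _ = sym (stable u′ Su′ (inj₁ u<u′) γ ≺-irrefl)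
    ... | tri≈ _ u≈u′ _ = u≈u′ γ
    ... | tri> _ _ u′<u = stable′ u Su (inj₁ u′<u) γ ≺-irrefl

    witness-value : ∀ {u γ} → SupWitness O S u γ → at s γ ≡ at u γ
    witness-value {u} {γ} wu with spec γ
    ... | inj₁ (u′ , wu′ , su′) = trans su′ (witnesses-agree wu′ wu)
    ... | inj₂ (none , _) = ⊥-elim (none (u , wu))

    witness-agreeBelow : ∀ {u γ} → SupWitness O S u γ → AgreeBelow u s γ
    witness-agreeBelow wu δ δ<γ = sym (witness-value (witness-below wu δ<γ))

    non-witness-overtaken : ∀ {y γ} → S y → at y γ ≢ undef → ¬ SupWitness O S y γ →
      Σ Sur λ u → S u × Σ Carrier λ δ → AgreeBelow y u δ × at y δ <ᵛ at u δ × ¬ γ ≺ δ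
    non-witness-overtaken {y} {γ} Sy yd not-witness
      with ¬∀⇒∃¬ (λ stable → not-witness (Sy , yd , stable))
    ... | u , not-stable with ¬→⇒× not-stable
    ...   | Su , not-stable′ with ¬→⇒× not-stable′
    ...     | y≤u , disagree with ¬∀⇒∃¬ disagree
    ...       | ε , disagree-at-ε with ¬→⇒× disagree-at-ε
    ...         | ε≤γ , u≢y with y≤u
    ...           | inj₂ y≈u = ⊥-elim (u≢y (sym (y≈u ε)))
    ...           | inj₁ (δ , ag , lt) =
      u , Su , δ , ag , lt , λ γ<δ → u≢y (sym (ag ε (≮-≺-trans ε≤γ γ<δ)))

    sup*-≮-member : ∀ {y} → S y → ¬ s <S y
    sup*-≮-member Sy (γ , ag , lt) = go γ (wellFounded γ) Sy ag lt
      where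
      go : ∀ γ → Acc _≺_ γ → ∀ {y} → S y → AgreeBelow s y γ → at s γ <ᵛ at y γ → ⊥
      go γ (acc rs) {y} Sy ag lt with spec γ
      ... | inj₁ (u , wu@(_ , _ , stable) , su) =
        <ᵛ-irrefl (subst (_ <ᵛ_) (stable y Sy (inj₁ u<y) γ ≺-irrefl) u<y-at-γ)
        where
        u<y-at-γ = subst (_<ᵛ _) su lt
        u<y : u <S y
        u<y = γ , (λ δ d → trans (witness-agreeBelow wu δ d) (ag δ d)) , u<y-at-γ
      ... | inj₂ (none , su)
        with non-witness-overtaken Sy (λ yu → pos≢undef (trans (sym (undef<⇒pos (subst (_<ᵛ _) su lt))) yu))
                                      (λ wy → none (y , wy))
      ...   | u , Su , δ , agyu , ltyu , δ≤γ with compare δ γ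
      ...     | tri< δ<γ _ _ = go δ (rs δ<γ) Su (λ δ′ d → trans (ag δ′ (≺-trans d δ<γ)) (agyu δ′ d))
                                 (subst (_<ᵛ _) (sym (ag δ δ<γ)) ltyu)
      ...     | tri≈ _ refl _ = pos-maximal (subst (_<ᵛ _) (undef<⇒pos (subst (_<ᵛ _) su lt)) ltyu)
      ...     | tri> _ _ γ<δ = δ≤γ γ<δ

    larger-member : ∀ {y} → S y → Σ Sur λ u → S u × y <S u
    larger-member {y} Sy with ¬∀⇒∃¬ (λ y-max → noMax (y , Sy , y-max))
    ... | u , not-below with ¬→⇒× not-below
    ...   | Su , u≰y with <S-cmp y u
    ...     | tri< y<u _ _ = u , Su , y<u
    ...     | tri≈ _ y≈u _ = ⊥-elim (u≰y (inj₂ (≈S-sym {y} {u} y≈u)))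
    ...     | tri> _ _ u<y = ⊥-elim (u≰y (inj₁ u<y))

    member-<-sup* : ∀ {y} → S y → y <S s
    member-<-sup* {y} Sy with <S-cmp y s
    ... | tri< y<s _ _ = y<s
    ... | tri> _ _ s<y = ⊥-elim (sup*-≮-member Sy s<y)
    ... | tri≈ _ y≈s _ with larger-member Sy
    ...   | u , Su , y<u = ⊥-elim (sup*-≮-member Su (<S-respˡ-≈ {s} {y} {u} (≈S-sym {y} {s} y≈s) y<u))

    member-≢neg-where-sup*-ends : ∀ {y γ} → S y → AgreeBelow y s γ → at s γ ≡ undef → at y γ ≢ neg
    member-≢neg-where-sup*-ends {y} {γ} Sy ag su yn with spec γ
    ... | inj₁ (u , (_ , ud , _) , su′) = ud (trans (sym su′) su)
    ... | inj₂ (none , _)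
      with non-witness-overtaken Sy (λ yu → neg≢undef (trans (sym yn) yu)) (λ wy → none (y , wy))
    ...   | u , Su , δ , agyu , ltyu , δ≤γ with compare δ γ
    ...     | tri> _ _ γ<δ = δ≤γ γ<δ
    ...     | tri< δ<γ _ _ = sup*-≮-member Su (δ , s≡u , subst (_<ᵛ _) (ag δ δ<γ) ltyu)
      where s≡u = λ δ′ d → trans (sym (ag δ′ (≺-trans d δ<γ))) (agyu δ′ d)
    ...     | tri≈ _ refl _ =
      ≤S⇒≯ {s} {u} (ended-≤ {s} {u} s≡u su (subst (_<ᵛ _) yn ltyu)) (member-<-sup* Su)
      where s≡u = λ δ′ d → trans (sym (ag δ′ d)) (agyu δ′ d)

    member-<ʳ-sup* : ∀ {y} → S y → y <ʳ s
    member-<ʳ-sup* {y} Sy with member-<-sup* Sy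
    ... | γ , ag , lt with em {at s γ ≡ undef}
    ...   | no sd = γ , ag , lt , sd
    ...   | yes su = ⊥-elim (member-≢neg-where-sup*-ends Sy ag su (<undef⇒neg (subst (_ <ᵛ_) su lt)))

    attained : ∀ γ → at s γ ≢ undef → Attained S s γ
    attained γ sd with spec γ
    ... | inj₁ (u , wu , su) = u , proj₁ wu , witness-agreeBelow wu , inj₁ (sym su)
    ... | inj₂ (_ , su) = ⊥-elim (sd su)

  sup*-attained : ∀ {S s} → IsSupStar O S s → ∀ γ → at s γ ≢ undef → Attained S s γ
  sup*-attained {S} {s} (inj₁ (u , (Su , _) , ext)) = extension-attained {S} {u} {s} Su ext
  sup*-attained {S} {s} (inj₂ (noMax , spec)) = SupWithoutMax.attained S s noMax spec

  sup*-<ʳ : ∀ {S s y} → IsSupStar O S s → S y → y <ʳ s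
  sup*-<ʳ {s = s} {y} (inj₁ (u , (_ , greatest) , ext)) Sy = ≤⇒<ʳ-extension {y} {u} {s} (greatest y Sy) ext
  sup*-<ʳ {S} {s} (inj₂ (noMax , spec)) = SupWithoutMax.member-<ʳ-sup* S s noMax spec

  sup*-upper-bound-≮ʳ : ∀ {S s} → IsSupStar O S s → ∀ x → (∀ u → S u → u <S x) → ¬ x <ʳ s
  sup*-upper-bound-≮ʳ {S} {s} hs = attained-upper-bound-≮ʳ {S} {s} (sup*-attained {S} {s} hs)

  dual : Sur → Sur
  dual s = record
    { len        = len s
    ; at         = λ γ → flip (at s γ)
    ; def-below  = λ γ γ<len → flip-≢undef (def-below s γ γ<len)
    ; undef-from = λ γ γ≮len → cong flip (undef-from s γ γ≮len)
    }

  dual-<S : ∀ {x y} → x <S y → dual y <S dual x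
  dual-<S (γ , ag , lt) = γ , (λ δ d → cong flip (sym (ag δ d))) , flip-<ᵛ lt

  undual-<S : ∀ {x y} → dual x <S dual y → y <S x
  undual-<S (γ , ag , lt) = γ , (λ δ d → sym (flip-injective (ag δ d))) , flip-<ᵛ⁻¹ lt

  dual-≤S : ∀ {x y} → x ≤S y → dual y ≤S dual x
  dual-≤S {x} {y} (inj₁ x<y) = inj₁ (dual-<S {x} {y} x<y)
  dual-≤S (inj₂ x≈y) = inj₂ λ γ → cong flip (sym (x≈y γ))

  undual-≤S : ∀ {x y} → dual x ≤S dual y → y ≤S x
  undual-≤S {x} {y} (inj₁ x<y) = inj₁ (undual-<S {x} {y} x<y)
  undual-≤S (inj₂ x≈y) = inj₂ λ γ → sym (flip-injective (x≈y γ))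

  dual-<ˡ : ∀ {x y} → x <ˡ y → dual y <ʳ dual x
  dual-<ˡ (γ , ag , lt , xd) = γ , (λ δ d → cong flip (sym (ag δ d))) , flip-<ᵛ lt , flip-≢undef xd

  undual-<ʳ : ∀ {x y} → dual x <ʳ dual y → y <ˡ x
  undual-<ʳ (γ , ag , lt , yd) =
    γ , (λ δ d → sym (flip-injective (ag δ d))) , flip-<ᵛ⁻¹ lt , λ yu → yd (cong flip yu)

  -- dual (dual y) is only ≈ y, and T need not respect ≈, so T ∘ dual would not do.
  DualSet : (Sur → Set) → Sur → Set
  DualSet T x = Σ Sur λ y → T y × x ≈S dual y

  dual-extension : ∀ {v t} → IsExtend O v neg t → IsExtend O (dual v) pos (dual t)
  dual-extension ext δ = (λ δ<len → cong flip (proj₁ (ext δ) δ<len))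
                       , (λ δ≡len → cong flip (proj₁ (proj₂ (ext δ)) δ≡len))
                       , (λ len<δ → cong flip (proj₂ (proj₂ (ext δ)) len<δ))

  dual-witness : ∀ {T v γ} → InfWitness O T v γ → SupWitness O (DualSet T) (dual v) γ
  dual-witness {v = v} (Tv , vd , stable) = (v , Tv , ≈S-refl {dual v}) , flip-≢undef vd
    , λ { u (y , Ty , u≈y) v≤u δ δ≤γ → trans (u≈y δ) (cong flip
          (stable y Ty (undual-≤S {v} {y} (≤S-respʳ-≈ {dual v} {u} {dual y} v≤u u≈y)) δ δ≤γ)) }

  undual-witness : ∀ {T u γ} → SupWitness O (DualSet T) u γ → Σ Sur λ y → InfWitness O T y γ
  undual-witness {u = u} ((y , Ty , u≈y) , ud , stable) = y , Ty , (λ yu → ud (trans (u≈y _) (cong flip yu)))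
    , λ v Tv v≤y δ δ≤γ → flip-injective (trans (stable (dual v) (v , Tv , ≈S-refl {dual v})
        (≤S-respˡ-≈ {u} {dual y} {dual v} u≈y (dual-≤S {v} {y} v≤y)) δ δ≤γ) (u≈y δ))

  dual-inf* : ∀ {T t} → IsInfStar O T t → IsSupStar O (DualSet T) (dual t)
  dual-inf* {T} {t} (inj₁ (v , (Tv , least) , ext)) =
    inj₁ (dual v , ((v , Tv , ≈S-refl {dual v}) , greatest) , dual-extension {v} {t} ext)
    where
    greatest : ∀ u → DualSet T u → u ≤S dual v
    greatest u (y , Ty , u≈y) = ≤S-respˡ-≈ {u} {dual y} {dual v} u≈y (dual-≤S {v} {y} (least y Ty))
  dual-inf* {T} {t} (inj₂ (noMin , spec)) = inj₂ (noMax , spec′)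
    where
    noMax : ¬ Σ Sur λ u → IsMax O (DualSet T) u
    noMax (u , (y , Ty , u≈y) , greatest) = noMin (y , Ty , λ v Tv → undual-≤S {v} {y}
      (≤S-respʳ-≈ {dual v} {u} {dual y} (greatest (dual v) (v , Tv , ≈S-refl {dual v})) u≈y))

    spec′ : ∀ γ → (Σ Sur λ u → SupWitness O (DualSet T) u γ × (at (dual t) γ ≡ at u γ))
                 ⊎ ((¬ Σ Sur λ u → SupWitness O (DualSet T) u γ) × (at (dual t) γ ≡ undef))
    spec′ γ with spec γ
    ... | inj₁ (v , wv , tv) = inj₁ (dual v , dual-witness {T} {v} wv , cong flip tv)
    ... | inj₂ (none , tu) = inj₂ ((λ (u , wu) → none (undual-witness {T} {u} wu)) , cong flip tu)

  inf*-<ˡ : ∀ {T t y} → IsInfStar O T t → T y → t <ˡ y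
  inf*-<ˡ {T} {t} {y} ht Ty =
    undual-<ʳ {y} {t} (sup*-<ʳ {DualSet T} {dual t} {dual y} (dual-inf* {T} {t} ht) (y , Ty , ≈S-refl {dual y}))

  inf*-lower-bound-≮ˡ : ∀ {T t} → IsInfStar O T t → ∀ x → (∀ v → T v → x <S v) → ¬ t <ˡ x
  inf*-lower-bound-≮ˡ {T} {t} ht x x<T t<x =
    sup*-upper-bound-≮ʳ {DualSet T} {dual t} (dual-inf* {T} {t} ht) (dual x) above (dual-<ˡ {t} {x} t<x)
    where
    above : ∀ u → DualSet T u → u <S dual x
    above u (y , Ty , u≈y) = <S-respˡ-≈ {u} {dual y} {dual x} u≈y (dual-<S {x} {y} (x<T y Ty))

  -- All that the analysis of sep needs to know about the pair (sup* S, inf* T).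
  Uncrossed : Sur → Sur → Set
  Uncrossed s t = ∀ γ → AgreeBelow s t γ → at s γ ≡ pos → at t γ ≡ neg → ⊥

  sup*-inf*-uncrossed : ∀ {S T s t} → (∀ u v → S u → T v → u <S v) →
    IsSupStar O S s → IsInfStar O T t → Uncrossed s t
  sup*-inf*-uncrossed {S} {T} {s} {t} S<T hs ht γ s≡t sp tn
    with sup*-attained {S} {s} hs γ (λ su → pos≢undef (trans (sym sp) su))
  ... | u , Su , u≡s , reach = inf*-lower-bound-≮ˡ {T} {t} ht u (λ v Tv → S<T u v Su Tv)
    (γ , (λ δ d → trans (sym (s≡t δ d)) (sym (u≡s δ d))) , subst (_<ᵛ _) (sym tn) (neg< reach)
       , λ tu → neg≢undef (trans (sym tn) tu))
    where
    neg< : at u γ ≡ at s γ ⊎ (at u γ ≡ undef × at s γ ≡ pos) → neg <ᵛ at u γ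
    neg< (inj₁ us)       = subst (neg <ᵛ_) (sym (trans us sp)) neg<pos
    neg< (inj₂ (uu , _)) = subst (neg <ᵛ_) (sym uu) neg<undef

  below-agreeing : ∀ {s w x} → (∀ δ → δ ≺ len s → at w δ ≡ at s δ) → x <ʳ s → x <S w
  below-agreeing {s} w≡s (γ , ag , lt , sd) =
    γ , (λ δ d → trans (ag δ d) (sym (w≡s δ (≺-trans d γ<len))))
      , subst (_ <ᵛ_) (sym (w≡s γ γ<len)) lt
    where γ<len = defined⇒<len s sd

  above-agreeing : ∀ {t w x} → (∀ δ → δ ≺ len t → at w δ ≡ at t δ) → t <ˡ x → w <S x
  above-agreeing {t} w≡t (γ , ag , lt , td) =
    γ , (λ δ d → trans (w≡t δ (≺-trans d γ<len)) (ag δ d)) , subst (_<ᵛ _) (sym (w≡t γ γ<len)) lt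
    where γ<len = defined⇒<len t td

  below-neg-cut : ∀ {s w ε x} → IsRestr O w s ε → at s ε ≡ neg → x <ʳ s → x <S w
  below-neg-cut {s} {w} {ε} {x} w=s↾ sn (γ , ag , lt , _) with compare γ ε
  ... | tri< γ<ε _ _ = γ , (λ δ d → trans (ag δ d) (sym (proj₁ (w=s↾ δ) (≺-trans d γ<ε))))
                         , subst (_ <ᵛ_) (sym (proj₁ (w=s↾ γ) γ<ε)) lt
  ... | tri≈ _ refl _ = ⊥-elim (neg-minimal (subst (_ <ᵛ_) sn lt))
  ... | tri> _ _ ε<γ = <S-at {x} {w} (λ δ d → trans (ag δ (≺-trans d ε<γ)) (sym (proj₁ (w=s↾ δ) d)))
                         (trans (ag ε ε<γ) sn) (proj₂ (w=s↾ ε) ≺-irrefl) neg<undef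

  above-pos-cut : ∀ {t w ε x} → IsRestr O w t ε → at t ε ≡ pos → t <ˡ x → w <S x
  above-pos-cut {t} {w} {ε} {x} w=t↾ tp (γ , ag , lt , _) with compare γ ε
  ... | tri< γ<ε _ _ = γ , (λ δ d → trans (proj₁ (w=t↾ δ) (≺-trans d γ<ε)) (ag δ d))
                         , subst (_<ᵛ _) (sym (proj₁ (w=t↾ γ) γ<ε)) lt
  ... | tri≈ _ refl _ = ⊥-elim (pos-maximal (subst (_<ᵛ _) tp lt))
  ... | tri> _ _ ε<γ = <S-at {w} {x} (λ δ d → trans (proj₁ (w=t↾ δ) d) (ag δ (≺-trans d ε<γ)))
                         (proj₂ (w=t↾ ε) ≺-irrefl) (trans (sym (ag ε ε<γ)) tp) undef<pos

  CutAtFirst : Val → Carrier → Sur → Sur → Set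
  CutAtFirst v α t w =
      (Σ Carrier λ ε → ¬ (ε ≺ α) × (at t ε ≡ v)
         × (∀ δ → ¬ (δ ≺ α) → δ ≺ ε → at t δ ≢ v) × IsRestr O w t ε)
    ⊎ ((∀ ε → ¬ (ε ≺ α) → at t ε ≢ v) × (w ≈S t))

  module Cut {v α t w} (cut : CutAtFirst v α t w) where

    agreeLe : ∀ {δ} → at w δ ≢ undef → AgreeLe O w t δ
    agreeLe wd = [ (λ { (_ , _ , _ , _ , w=t↾) →
                        restriction-agreeLe {w} {t} w=t↾ (restriction-defined⇒< {w} {t} w=t↾ wd) })
                 , (λ { (_ , w≈t) δ′ _ → w≈t δ′ }) ]′ cut

    avoids : ∀ {δ} → at w δ ≢ undef → ¬ δ ≺ α → at t δ ≢ v
    avoids {δ} wd δ≮α =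
      [ (λ { (_ , _ , _ , first , w=t↾) → first δ δ≮α (restriction-defined⇒< {w} {t} w=t↾ wd) })
      , (λ { (avoid , _) → avoid δ δ≮α }) ]′ cut

    agrees-below : ∀ {δ} → δ ≺ α → at w δ ≡ at t δ
    agrees-below {δ} δ<α =
      [ (λ { (_ , ε≮α , _ , _ , w=t↾) → proj₁ (w=t↾ δ) (≺-≮-trans δ<α ε≮α) })
      , (λ { (_ , w≈t) → w≈t δ }) ]′ cut

  cut-pos-above : ∀ {α t w x} → CutAtFirst pos α t w → t <ˡ x → w <S x
  cut-pos-above {t = t} {w} {x} (inj₁ (ε , _ , tp , _ , w=t↾)) = above-pos-cut {t} {w} {ε} {x} w=t↾ tp
  cut-pos-above {t = t} {w} {x} (inj₂ (_ , w≈t)) = above-agreeing {t} {w} {x} λ δ _ → w≈t δ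

  cut-neg-below : ∀ {α s w x} → CutAtFirst neg α s w → x <ʳ s → x <S w
  cut-neg-below {s = s} {w} {x} (inj₁ (ε , _ , sn , _ , w=s↾)) = below-neg-cut {s} {w} {ε} {x} w=s↾ sn
  cut-neg-below {s = s} {w} {x} (inj₂ (_ , w≈s)) = below-agreeing {s} {w} {x} λ δ _ → w≈s δ

  LowerPin : Sur → Sur → Carrier → Set
  LowerPin w s δ = at w δ ≡ neg ⊎ AgreeLe O w s δ

  UpperPin : Sur → Sur → Carrier → Set
  UpperPin w t δ = at w δ ≡ pos ⊎ AgreeLe O w t δ

  Pinned : Sur → Sur → Sur → Set
  Pinned s t w = ∀ δ → at w δ ≢ undef → LowerPin w s δ × UpperPin w t δ

  lower-pin-≮ : ∀ {x s w δ} → ¬ x <ʳ s → AgreeBelow x w δ → at w δ ≢ undef →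
    LowerPin w s δ → ¬ at x δ <ᵛ at w δ
  lower-pin-≮ _ _ _ (inj₁ wn) lt = neg-minimal (subst (_ <ᵛ_) wn lt)
  lower-pin-≮ {x} {s} {w} {δ} x≮s x≡w wd (inj₂ w≡s) lt = x≮s
    (δ , (λ δ′ d → trans (x≡w δ′ d) (agreeLe⇒agreeBelow {w} {s} w≡s δ′ d))
       , subst (_ <ᵛ_) w≡s-at lt , λ su → wd (trans w≡s-at su))
    where w≡s-at = agreeLe-at {w} {s} w≡s

  upper-pin-≯ : ∀ {x t w δ} → ¬ t <ˡ x → AgreeBelow x w δ → at w δ ≢ undef →
    UpperPin w t δ → ¬ at w δ <ᵛ at x δ
  upper-pin-≯ _ _ _ (inj₁ wp) gt = pos-maximal (subst (_<ᵛ _) wp gt)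
  upper-pin-≯ {x} {t} {w} {δ} t≮x x≡w wd (inj₂ w≡t) gt = t≮x
    (δ , (λ δ′ d → sym (trans (x≡w δ′ d) (agreeLe⇒agreeBelow {w} {t} w≡t δ′ d)))
       , subst (_<ᵛ _) w≡t-at gt , λ tu → wd (trans w≡t-at tu))
    where w≡t-at = agreeLe-at {w} {t} w≡t

  pinned-value : ∀ {x s t w δ} → ¬ x <ʳ s → ¬ t <ˡ x → AgreeBelow x w δ → at w δ ≢ undef →
    LowerPin w s δ × UpperPin w t δ → at x δ ≡ at w δ
  pinned-value {x} {s} {t} {w} {δ} x≮s t≮x x≡w wd (lower , upper) with <ᵛ-cmp (at x δ) (at w δ)
  ... | tri≈ _ x≡w-at _ = x≡w-at
  ... | tri< lt _ _ = ⊥-elim (lower-pin-≮ {x} {s} {w} x≮s x≡w wd lower lt)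
  ... | tri> _ _ gt = ⊥-elim (upper-pin-≯ {x} {t} {w} t≮x x≡w wd upper gt)

  pinned⇒prolongment : ∀ {s t w x} → Pinned s t w → ¬ x <ʳ s → ¬ t <ˡ x → IsProlongment O x w
  pinned⇒prolongment {s} {t} {w} {x} pins x≮s t≮x =
    len w , λ δ → (λ δ<len → sym (agree δ (wellFounded δ) (def-below w δ δ<len))) , undef-from w δ
    where
    agree : ∀ δ → Acc _≺_ δ → at w δ ≢ undef → at x δ ≡ at w δ
    agree δ (acc rs) wd = pinned-value {x} {s} {t} {w} x≮s t≮x
      (λ δ′ d → agree δ′ (rs d) (defined-below w d wd)) wd (pins δ wd)

  prolongment-≮len : ∀ {x w} → IsProlongment O x w → ¬ len x ≺ len w
  prolongment-≮len {x} {w} (γ , w=x↾) len-x<len-w = def-below w (len x) len-x<len-w w-undef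
    where
    w-undef : at w (len x) ≡ undef
    w-undef with em {len x ≺ γ}
    ... | yes len<γ = trans (proj₁ (w=x↾ (len x)) len<γ) (undef-at-len x)
    ... | no len≮γ  = proj₂ (w=x↾ (len x)) len≮γ

  record Splits (s t w : Sur) : Set where
    field
      below-w : ∀ {x} → x <ʳ s → x <S w
      above-w : ∀ {x} → t <ˡ x → w <S x
      pinned  : Pinned s t w

  splits-equal : ∀ {s t w} → s ≈S t → w ≈S s → Splits s t w
  splits-equal {s} {t} {w} s≈t w≈s = record
    { below-w = λ {x} → below-agreeing {s} {w} {x} λ δ _ → w≈s δ
    ; above-w = λ {x} → above-agreeing {t} {w} {x} λ δ _ → trans (w≈s δ) (s≈t δ)
    ; pinned  = λ δ _ → inj₂ (λ δ′ _ → w≈s δ′) , inj₂ (λ δ′ _ → trans (w≈s δ′) (s≈t δ′))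
    }

  splits-first-difference : ∀ {s t w γ} → Uncrossed s t → Differ O s t γ →
    (∀ δ → δ ≺ γ → ¬ Differ O s t δ) → IsRestr O w s γ → Splits s t w
  splits-first-difference {s} {t} {w} {γ} uncrossed (sd , td , s≢t) first w=s↾ = record
    { below-w = λ {x} → below-neg-cut {s} {w} {γ} {x} w=s↾ (proj₁ signs)
    ; above-w = λ {x} → above-pos-cut {t} {w} {γ} {x} w=t↾ (proj₂ signs)
    ; pinned  = λ δ wd → let δ<γ = restriction-defined⇒< {w} {s} w=s↾ wd in
                  inj₂ (restriction-agreeLe {w} {s} w=s↾ δ<γ)
                , inj₂ (restriction-agreeLe {w} {t} w=t↾ δ<γ)
    }
    where
    s≡t : AgreeBelow s t γ
    s≡t δ δ<γ = dne λ s≢t′ → first δ δ<γ (defined-below s δ<γ sd , defined-below t δ<γ td , s≢t′)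

    w=t↾ : IsRestr O w t γ
    w=t↾ δ = (λ δ<γ → trans (proj₁ (w=s↾ δ) δ<γ) (s≡t δ δ<γ)) , proj₂ (w=s↾ δ)

    signs : at s γ ≡ neg × at t γ ≡ pos
    signs with defined-≢⇒signs sd td s≢t
    ... | inj₁ neg-pos = neg-pos
    ... | inj₂ (sp , tn) = ⊥-elim (uncrossed γ s≡t sp tn)

  splits-prolongment-pos : ∀ {s t w} → IsProperProlongment O t s → CutAtFirst pos (len s) t w →
    Splits s t w
  splits-prolongment-pos {s} {t} {w} (_ , _ , s=t↾) cut = record
    { below-w = λ {x} → below-agreeing {s} {w} {x} λ δ δ<len →
        trans (agrees-below δ<len) (sym (restriction-agrees {s} {t} s=t↾ δ<len))
    ; above-w = λ {x} → cut-pos-above {len s} {t} {w} {x} cut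
    ; pinned  = λ δ wd → lower δ wd , inj₂ (agreeLe wd)
    }
    where
    open Cut {pos} {len s} {t} {w} cut

    lower : ∀ δ → at w δ ≢ undef → LowerPin w s δ
    lower δ wd with em {δ ≺ len s}
    ... | yes δ<len = inj₂ λ δ′ δ′≤δ → trans (agreeLe wd δ′ δ′≤δ)
                        (sym (restriction-agrees {s} {t} s=t↾ (≮-≺-trans δ′≤δ δ<len)))
    ... | no δ≮len =
      inj₁ (trans w≡t (defined-≢pos⇒neg (λ tu → wd (trans w≡t tu)) (avoids wd δ≮len)))
      where w≡t = agreeLe-at {w} {t} (agreeLe wd)

  splits-prolongment-neg : ∀ {s t w} → IsProperProlongment O s t → CutAtFirst neg (len t) s w →
    Splits s t w
  splits-prolongment-neg {s} {t} {w} (_ , _ , t=s↾) cut = record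
    { below-w = λ {x} → cut-neg-below {len t} {s} {w} {x} cut
    ; above-w = λ {x} → above-agreeing {t} {w} {x} λ δ δ<len →
        trans (agrees-below δ<len) (sym (restriction-agrees {t} {s} t=s↾ δ<len))
    ; pinned  = λ δ wd → inj₂ (agreeLe wd) , upper δ wd
    }
    where
    open Cut {neg} {len t} {s} {w} cut

    upper : ∀ δ → at w δ ≢ undef → UpperPin w t δ
    upper δ wd with em {δ ≺ len t}
    ... | yes δ<len = inj₂ λ δ′ δ′≤δ → trans (agreeLe wd δ′ δ′≤δ)
                        (sym (restriction-agrees {t} {s} t=s↾ (≮-≺-trans δ′≤δ δ<len)))
    ... | no δ≮len =
      inj₁ (trans w≡s (defined-≢neg⇒pos (λ su → wd (trans w≡s su)) (avoids wd δ≮len)))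
      where w≡s = agreeLe-at {w} {s} (agreeLe wd)

  sep-splits : ∀ {s t w} → Uncrossed s t → IsSep O s t w → Splits s t w
  sep-splits _ (inj₁ (s≈t , w≈s)) = splits-equal s≈t w≈s
  sep-splits uncrossed (inj₂ (inj₁ (_ , differ , first , w=s↾))) =
    splits-first-difference uncrossed differ first w=s↾
  sep-splits _ (inj₂ (inj₂ (inj₁ (t>s , cut)))) = splits-prolongment-pos t>s cut
  sep-splits _ (inj₂ (inj₂ (inj₂ (s>t , cut)))) = splits-prolongment-neg s>t cut

theorem5p5 : (O : WellOrder) → ExcludedMiddle 0ℓ →
    (S T : Surreal O → Set) →
    (∀ u v → S u → T v → _<ˢ_ O u v) →
    (s t w : Surreal O) → IsSupStar O S s → IsInfStar O T t → IsSep O s t w →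
    Separates O w S T
    × (∀ x → Separates O x S T → ¬ (WellOrder._<_ O (len x) (len w)))
    × (∀ x → Separates O x S T → IsProlongment O x w)
theorem5p5 O em S T S<T s t w hs ht hsep =
  ((λ u Su → below-w {u} (sup*-<ʳ {S} {s} {u} hs Su)) , (λ v Tv → above-w {v} (inf*-<ˡ {T} {t} {v} ht Tv))) ,
  (λ x x-separates → prolongment-≮len {x} {w} (prolongs x x-separates)) ,
  prolongs
  where
  open Separators O em
  open Splits (sep-splits {s} {t} {w} (sup*-inf*-uncrossed {S} {T} {s} {t} S<T hs ht) hsep)

  prolongs : ∀ x → Separates O x S T → IsProlongment O x w
  prolongs x (S<x , x<T) = pinned⇒prolongment {s} {t} {w} {x} pinned
    (sup*-upper-bound-≮ʳ {S} {s} hs x S<x) (inf*-lower-bound-≮ˡ {T} {t} ht x x<T)
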